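{- For every maximal $k$-dominating-sequence $(v_1,\ldots,v_s)$ (of some vertex of $G$) and every $i\le s-1$, we have $v_{i+1}\in\mathcal{P}(v_i)$, $|N(v_i)|\ge\ell$, and $|\mathcal{P}(v_i)|\le(2k)^{2k+1}$.
   Context: Graphs are finite, simple, undirected. $N(v)$ is the open and $N[v]=N(v)\cup\{v\}$ the closed neighborhood. $\nabla_1(G)$ is the maximum of $|E(H)|/|V(H)|$ over all $1$-shallow minors $H$ of $G$ (graphs obtained from pairwise vertex-disjoint connected subgraphs of $G$ of radius at most $1$ as branch sets, two vertices adjacent when some edge of $G$ joins their branch sets). Standing assumptions: $G$ is a fixed graph such that for every $v\in V(G)$, $N(v)$ can be dominated by at most $2\nabla_1(G)$ vertices different from $v$. Set $k=2\nabla_1(G)$, $\alpha=1/k$, $\ell=4k^3+1$, $q=4k^4$; $t$ is the least integer such that $G$ has no $K_{t,t}$ subgraph. A vertex $z$ is $\alpha$-strong for $W$ if $|N[z]\cap W|\ge\alpha|W|$. A pseudo-cover of $W$ is a sequence $(u_1,\ldots,u_m)$ with $m\le k$, $|W\setminus\bigcup_{i\le m}N[u_i]|\le q$, and for every $i\le m$: $u_i$ is $\alpha$-strong for $W\setminus\bigcup_{j<i}N[u_j]$ and $|N[u_i]\cap(W\setminus\bigcup_{j<i}N[u_j])|\ge\ell$. $\mathcal{P}(u)$ is the set of all vertices appearing in some pseudo-cover of $N(u)$ if $|N(u)|>\ell$, and $\mathcal{P}(u)=\emptyset$ otherwise. A $k$-dominating-sequence of $v$ is a sequence $(v_1,\ldots,v_s)$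 for which there are sets $B_1,\ldots,B_s$ with: $v_1=v$, $B_1\subseteq N(v_1)$; $B_i\subseteq N(v_i)\cap B_{i-1}$ for $2\le i\le s$; $|B_i|\ge k^{t-i}(2t-i+(t-i)q)$ for all $i\le s$; and $v_i\in\mathcal{P}(v_{i-1})$ for $2\le i\le s$. It is maximal if there is no vertex $u$ such that $(v_1,\ldots,v_s,u)$ is a $k$-dominating-sequence of $v$. -}

module Defs where

open import Data.Nat as ℕ using (ℕ; zero; suc; _∸_)
open import Data.Integer as ℤ using (ℤ)
open import Data.Rational using (ℚ; _/_; _+_; _*_; _-_; _≤_; _<_; 0ℚ; 1ℚ)
open import Data.Bool using (Bool; true; false; _∧_; _∨_; if_then_else_)
import Data.Fin
open import Data.Fin using (Fin; toℕ)
open import Data.Fin.Subset using (Subset; _∩_; _∪_; ∁; ⁅_⁆; _⊆_; _∈_; ∣_∣; ⊥)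
open import Data.Vec using (tabulate; lookup)
open import Data.List.Relation.Unary.All using (All)
open import Data.Unit using (⊤)
open import Data.List using (List; []; _∷_; length)
import Data.List.Membership.Propositional as LM
open import Data.Product using (Σ; _×_; ∃; ∃-syntax)
open import Relation.Binary.PropositionalEquality using (_≡_; _≢_)
open import Relation.Nullary using (¬_)
open import Function.Bundles using (_⇔_)
open import Data.Empty using () renaming (⊥ to Empty)

record Graph : Set where
  field
    n     : ℕ
    adj   : Fin n → Fin n → Bool
    sym   : ∀ u v → adj u v ≡ adj v u
    irrefl : ∀ v → adj v v ≡ false
open Graph public

ℕ→ℚ : ℕ → ℚ
ℕ→ℚ m = ℤ.+ m / 1

_^ℚ_ : ℚ → ℕ → ℚ
x ^ℚ zero  = 1ℚ
x ^ℚ suc m = x * (x ^ℚ m)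

-- "x ≤ y ^ r" for nonnegative rationals x, y and a nonnegative rational
-- exponent r: by definition y ^ (p/d) = (y ^ p) ^ (1/d), so for every
-- representation r = p/d (d > 0) this means x ^ d ≤ y ^ p.
LeRatPow : ℚ → ℚ → ℚ → Set
LeRatPow x y r = ∀ (p d : ℕ) → 0 ℕ.< d → ℕ→ℚ p ≡ r * ℕ→ℚ d → (x ^ℚ d) ≤ (y ^ℚ p)

anyFin : ∀ {m} → (Fin m → Bool) → Bool
anyFin {zero}  f = false
anyFin {suc m} f = f Data.Fin.zero ∨ anyFin (λ i → f (Data.Fin.suc i))

sumFin : ∀ {m} → (Fin m → ℕ) → ℕ
sumFin {zero}  f = 0
sumFin {suc m} f = f Data.Fin.zero ℕ.+ sumFin (λ i → f (Data.Fin.suc i))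

countFin : ∀ {m} → (Fin m → Bool) → ℕ
countFin {zero}  f = 0
countFin {suc m} f = (if f Data.Fin.zero then 1 else 0) ℕ.+ countFin (λ i → f (Data.Fin.suc i))

module _ (G : Graph) where

  N : Fin (n G) → Subset (n G)
  N v = tabulate (adj G v)

  N[_] : Fin (n G) → Subset (n G)
  N[ v ] = N v ∪ ⁅ v ⁆

  ⋃N[] : List (Fin (n G)) → Subset (n G)
  ⋃N[] []       = ⊥
  ⋃N[] (u ∷ us) = N[ u ] ∪ ⋃N[] us

_∖_ : ∀ {m} → Subset m → Subset m → Subset m
A ∖ B = A ∩ ∁ B

module _ (G : Graph) where

  -- A 1-shallow minor: m pairwise disjoint branch sets, each inducing a
  -- connected subgraph of radius ≤ 1 (i.e. nonempty with a centre c in it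
  -- such that every vertex of the set is c or adjacent to c).
  record ShallowMinor₁ : Set where
    field
      m        : ℕ
      branch   : Fin m → Subset (n G)
      disjoint : ∀ a b → a ≢ b → ∀ x → x ∈ branch a → ¬ (x ∈ branch b)
      centre   : Fin m → Fin (n G)
      centre∈  : ∀ a → centre a ∈ branch a
      radius₁  : ∀ a → branch a ⊆ N[_] G (centre a)

    inB : Fin m → Fin (n G) → Bool
    inB a x = lookup (branch a) x

    adjH : Fin m → Fin m → Bool
    adjH a b = anyFin (λ x → anyFin (λ y → inB a x ∧ inB b y ∧ adj G x y))

    edges : ℕ
    edges = sumFin (λ a → countFin (λ b → (toℕ a ℕ.<ᵇ toℕ b) ∧ adjH a b))

  -- ∇₁(G) = nabla: the maximum of |E(H)|/|V(H)| over (nonempty)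
  -- 1-shallow minors H of G (bound attained, and an upper bound)
  IsNabla₁ : ℚ → Set
  IsNabla₁ nabla =
    (∀ (H : ShallowMinor₁) → 0 ℕ.< ShallowMinor₁.m H →
       ℕ→ℚ (ShallowMinor₁.edges H) ≤ nabla * ℕ→ℚ (ShallowMinor₁.m H))
    × (∃[ H ] (0 ℕ.< ShallowMinor₁.m H ×
       ℕ→ℚ (ShallowMinor₁.edges H) ≡ nabla * ℕ→ℚ (ShallowMinor₁.m H)))

  DominatedBy : Subset (n G) → List (Fin (n G)) → Set
  DominatedBy X D = X ⊆ ⋃N[] G D

  StandingAssumption : ℚ → Set
  StandingAssumption k = ∀ v → ∃[ D ] (ℕ→ℚ (length D) ≤ k × All (_≢ v) D × DominatedBy (N G v) D)

  HasKtt : ℕ → Set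
  HasKtt t = ∃[ A ] ∃[ B ] (∣ A ∣ ≡ t × ∣ B ∣ ≡ t × (∀ x → x ∈ A → ¬ (x ∈ B))
             × (∀ a b → a ∈ A → b ∈ B → adj G a b ≡ true))

  IsLeastNoKtt : ℕ → Set
  IsLeastNoKtt t = ¬ HasKtt t × (∀ t′ → t′ ℕ.< t → HasKtt t′)

  module Params (k : ℚ) where

    ℓ : ℚ
    ℓ = ℕ→ℚ 4 * (k ^ℚ 3) + 1ℚ

    q : ℚ
    q = ℕ→ℚ 4 * (k ^ℚ 4)

    -- z is α-strong for W (α = 1/k): |N[z] ∩ W| ≥ (1/k)|W|,
    -- written multiplied out as |W| ≤ k · |N[z] ∩ W|
    Strong : Fin (n G) → Subset (n G) → Set
    Strong z W = ℕ→ℚ ∣ W ∣ ≤ k * ℕ→ℚ ∣ N[_] G z ∩ W ∣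

    -- the per-step conditions of a pseudo-cover, with W the current
    -- remainder W ∖ ⋃_{j<i} N[u_j]
    Steps : Subset (n G) → List (Fin (n G)) → Set
    Steps W []       = ⊤
    Steps W (u ∷ us) = Strong u W × ℓ ≤ ℕ→ℚ ∣ N[_] G u ∩ W ∣ × Steps (W ∖ N[_] G u) us

    PseudoCover : Subset (n G) → List (Fin (n G)) → Set
    PseudoCover W us = ℕ→ℚ (length us) ≤ k × ℕ→ℚ ∣ W ∖ ⋃N[] G us ∣ ≤ q × Steps W us

    InP : Fin (n G) → Fin (n G) → Set
    InP u z = ℓ < ℕ→ℚ ∣ N G u ∣ × ∃[ us ] (PseudoCover (N G u) us × z LM.∈ us)

    -- the lower bound k^{t-i}(2t - i + (t-i)q) on |B_i|, for an integer
    -- exponent t-i (for i > t, k^{t-i} = 1/k^{i-t}, multiplied out)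
    BoundB : ℕ → ℕ → ℕ → Set
    BoundB t i b with i ℕ.≤ᵇ t
    ... | true  = (k ^ℚ (t ∸ i)) * c ≤ ℕ→ℚ b
      where c = ℕ→ℚ (2 ℕ.* t) - ℕ→ℚ i + (ℕ→ℚ t - ℕ→ℚ i) * q
    ... | false = c ≤ ℕ→ℚ b * (k ^ℚ (i ∸ t))
      where c = ℕ→ℚ (2 ℕ.* t) - ℕ→ℚ i + (ℕ→ℚ t - ℕ→ℚ i) * q

    -- (v 1, …, v s) (1-based; values of vs outside 1..s are irrelevant)
    -- is a k-dominating-sequence of v
    IsKDS : ℕ → Fin (n G) → ℕ → (ℕ → Fin (n G)) → Set
    IsKDS t v s vs = 1 ℕ.≤ s × vs 1 ≡ v × Σ (ℕ → Subset (n G)) λ Bs →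
      ( Bs 1 ⊆ N G (vs 1)
      × (∀ i → 2 ℕ.≤ i → i ℕ.≤ s → Bs i ⊆ (N G (vs i) ∩ Bs (i ∸ 1)))
      × (∀ i → 1 ℕ.≤ i → i ℕ.≤ s → BoundB t i ∣ Bs i ∣)
      × (∀ i → 2 ℕ.≤ i → i ℕ.≤ s → InP (vs (i ∸ 1)) (vs i)) )

    extend : ℕ → (ℕ → Fin (n G)) → Fin (n G) → ℕ → Fin (n G)
    extend s vs u i = if i ℕ.≡ᵇ suc s then u else vs i

    IsMaximalKDS : ℕ → Fin (n G) → ℕ → (ℕ → Fin (n G)) → Set
    IsMaximalKDS t v s vs = IsKDS t v s vs × (∀ u → ¬ IsKDS t v (suc s) (extend s vs u))

    CardPBound : Fin (n G) → Set
    CardPBound u = ∀ (P : Subset (n G)) → (∀ z → (z ∈ P) ⇔ InP u z) →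
      LeRatPow (ℕ→ℚ ∣ P ∣) (ℕ→ℚ 2 * k) (ℕ→ℚ 2 * k + 1ℚ)

-- The first two claims are part of the definition of a k-dominating sequence.
-- Call z admissible for W if it is α-strong for W and |N[z] ∩ W| ≥ ℓ, i.e. z may extend a pseudo-cover
-- whose uncovered part is W. If a set Z of r = ⌊2k²⌋ + 1 vertices were admissible for W, every z ∈ Z
-- would have at least |W|/k - r neighbours in W ∖ Z, so the subgraph induced on Z ∪ W, a 1-shallow
-- minor with singleton branch sets, would have at least r|W|/k - r² and at most ∇₁(r + |W|) edges;
-- with |W| ≥ ℓ = 4k³ + 1 this is impossible. So at most c = ⌊2k²⌋ vertices are admissible for any W.
-- A pseudo-cover has length at most K = ⌊k⌋, so the vertices of all pseudo-covers of N(u) lie in a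
-- tree of depth K and branching c, and |𝒫(u)| ≤ K c^K ≤ k (2k²)^K ≤ (2k)^(2k+1).

module Submission where

module PseudoCovers where

  open import Defs hiding (sym)
  open import Data.Nat as ℕ using (ℕ; zero; suc; z≤n; s≤s; _∸_)
  import Data.Nat.Properties as ℕP
  import Data.Nat.Coprimality as Cop
  import Data.Integer as ℤ
  import Data.Integer.Properties as ℤP
  open import Data.Rational as ℚ using (ℚ; mkℚ; _+_; _*_; _-_; -_; _≤_; _<_; 0ℚ; 1ℚ)
  open import Data.Rational.Properties
  import Data.Rational.Unnormalised as QU
  import Data.Rational.Unnormalised.Properties as QU
  import Data.Rational.Solver as ℚSolver
  import Data.Nat.Solver as ℕSolver
  open import Data.Bool using (Bool; true; false; _∧_; _∨_; if_then_else_)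
  import Data.Bool.Properties as BoolP
  open import Data.Fin using (Fin; toℕ) renaming (zero to fzero; suc to fsuc)
  import Data.Fin.Properties as FinP
  open import Data.Fin.Subset using (Subset; _∩_; _∪_; ∁; ⁅_⁆; _⊆_; _∈_; ∣_∣; ⊥; Nonempty)
  import Data.Fin.Subset.Properties as SubsetP
  open import Data.Vec using ([]; _∷_; here; there; tabulate; lookup)
  import Data.Vec.Properties as VecP
  open import Data.List using (List; []; _∷_; length; map; _++_)
  import Data.List.Properties as ListP
  open import Data.Nat.ListAction using (sum)
  open import Data.List.Membership.Propositional using () renaming (_∈_ to _∈ˡ_)
  import Data.List.Membership.Propositional.Properties as ∈ˡP
  open import Data.List.Relation.Unary.Any using (here; there)
  import Data.List.Relation.Unary.All as All
  open import Data.List.Relation.Unary.AllPairs using ([]; _∷_)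
  open import Data.List.Relation.Unary.Unique.Propositional using (Unique)
  import Data.List.Relation.Unary.Unique.Propositional.Properties as UniqueP
  open import Function using (_∘_)
  open import Data.Sum using (inj₁; inj₂)
  open import Data.Product using (_×_; _,_; proj₁; proj₂; ∃-syntax)
  open import Function.Bundles using (_⇔_; Equivalence)
  open import Relation.Nullary using (Dec; yes; no; does)
  open import Relation.Nullary.Decidable using (_×-dec_; decidable-stable)
  open import Data.Empty using (⊥-elim) renaming (⊥ to Empty)
  open import Relation.Binary.PropositionalEquality

  ℕ→ℚ≡mkℚ : ∀ m → ℕ→ℚ m ≡ mkℚ (ℤ.+ m) 0 (Cop.sym (Cop.1-coprimeTo m))
  ℕ→ℚ≡mkℚ m = normalize-coprime (Cop.sym (Cop.1-coprimeTo m))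

  ℕ→ℚ-mono-≤ : ∀ {a b} → a ℕ.≤ b → ℕ→ℚ a ≤ ℕ→ℚ b
  ℕ→ℚ-mono-≤ {a} {b} a≤b rewrite ℕ→ℚ≡mkℚ a | ℕ→ℚ≡mkℚ b =
    ℚ.*≤* (ℤP.*-monoʳ-≤-nonNeg (ℤ.+ 1) (ℤ.+≤+ a≤b))

  ℕ→ℚ-cancel-≤ : ∀ {a b} → ℕ→ℚ a ≤ ℕ→ℚ b → a ℕ.≤ b
  ℕ→ℚ-cancel-≤ {a} {b} h rewrite ℕ→ℚ≡mkℚ a | ℕ→ℚ≡mkℚ b =
    ℤP.drop‿+≤+ (ℤP.*-cancelʳ-≤-pos (ℤ.+ a) (ℤ.+ b) (ℤ.+ 1) (drop-*≤* h))

  ℕ→ℚ-mono-< : ∀ {a b} → a ℕ.< b → ℕ→ℚ a < ℕ→ℚ b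
  ℕ→ℚ-mono-< {a} {b} a<b rewrite ℕ→ℚ≡mkℚ a | ℕ→ℚ≡mkℚ b =
    ℚ.*<* (ℤP.*-monoʳ-<-pos (ℤ.+ 1) (ℤ.+<+ a<b))

  ℕ→ℚ-cancel-< : ∀ {a b} → ℕ→ℚ a < ℕ→ℚ b → a ℕ.< b
  ℕ→ℚ-cancel-< {a} {b} h rewrite ℕ→ℚ≡mkℚ a | ℕ→ℚ≡mkℚ b =
    ℤP.drop‿+<+ (ℤP.*-cancelʳ-<-nonNeg (ℤ.+ 1) (drop-*<* h))

  ℕ→ℚ-nonNeg : ∀ m → 0ℚ ≤ ℕ→ℚ m
  ℕ→ℚ-nonNeg m = ℕ→ℚ-mono-≤ {0} {m} z≤n

  ℕ→ℚ-suc : ∀ m → ℕ→ℚ (suc m) ≡ 1ℚ + ℕ→ℚ m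
  ℕ→ℚ-suc m = toℚᵘ-injective (QU.≃-trans (toℚᵘ-ℕ→ℚ-suc) (QU.≃-sym (toℚᵘ-homo-+ 1ℚ (ℕ→ℚ m))))
    where
    toℚᵘ-ℕ→ℚ-suc : ℚ.toℚᵘ (ℕ→ℚ (suc m)) QU.≃ ℚ.toℚᵘ 1ℚ QU.+ ℚ.toℚᵘ (ℕ→ℚ m)
    toℚᵘ-ℕ→ℚ-suc rewrite ℕ→ℚ≡mkℚ m | ℕ→ℚ≡mkℚ (suc m) | ℤP.+◃n≡+n (m ℕ.* 1) | ℕP.*-identityʳ m =
      QU.*≡* refl

  ℕ→ℚ-+ : ∀ a b → ℕ→ℚ (a ℕ.+ b) ≡ ℕ→ℚ a + ℕ→ℚ b
  ℕ→ℚ-+ zero    b = sym (+-identityˡ (ℕ→ℚ b))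
  ℕ→ℚ-+ (suc a) b = begin
    ℕ→ℚ (suc (a ℕ.+ b))   ≡⟨ ℕ→ℚ-suc (a ℕ.+ b) ⟩
    1ℚ + ℕ→ℚ (a ℕ.+ b)    ≡⟨ cong (1ℚ +_) (ℕ→ℚ-+ a b) ⟩
    1ℚ + (ℕ→ℚ a + ℕ→ℚ b) ≡⟨ +-assoc 1ℚ (ℕ→ℚ a) (ℕ→ℚ b) ⟨
    (1ℚ + ℕ→ℚ a) + ℕ→ℚ b ≡⟨ cong (_+ ℕ→ℚ b) (ℕ→ℚ-suc a) ⟨
    ℕ→ℚ (suc a) + ℕ→ℚ b  ∎
    where open ≡-Reasoning

  ℕ→ℚ-* : ∀ a b → ℕ→ℚ (a ℕ.* b) ≡ ℕ→ℚ a * ℕ→ℚ b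
  ℕ→ℚ-* zero    b = sym (*-zeroˡ (ℕ→ℚ b))
  ℕ→ℚ-* (suc a) b = begin
    ℕ→ℚ (b ℕ.+ a ℕ.* b)      ≡⟨ ℕ→ℚ-+ b (a ℕ.* b) ⟩
    ℕ→ℚ b + ℕ→ℚ (a ℕ.* b)    ≡⟨ cong (ℕ→ℚ b +_) (ℕ→ℚ-* a b) ⟩
    ℕ→ℚ b + ℕ→ℚ a * ℕ→ℚ b   ≡⟨ cong (_+ ℕ→ℚ a * ℕ→ℚ b) (*-identityˡ (ℕ→ℚ b)) ⟨
    1ℚ * ℕ→ℚ b + ℕ→ℚ a * ℕ→ℚ b ≡⟨ *-distribʳ-+ (ℕ→ℚ b) 1ℚ (ℕ→ℚ a) ⟨
    (1ℚ + ℕ→ℚ a) * ℕ→ℚ b    ≡⟨ cong (_* ℕ→ℚ b) (ℕ→ℚ-suc a) ⟨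
    ℕ→ℚ (suc a) * ℕ→ℚ b     ∎
    where open ≡-Reasoning

  ℕ→ℚ-^ : ∀ a j → ℕ→ℚ (a ℕ.^ j) ≡ ℕ→ℚ a ^ℚ j
  ℕ→ℚ-^ a zero    = refl
  ℕ→ℚ-^ a (suc j) = trans (ℕ→ℚ-* a (a ℕ.^ j)) (cong (ℕ→ℚ a *_) (ℕ→ℚ-^ a j))

  ^ℚ-+ : ∀ x a b → x ^ℚ (a ℕ.+ b) ≡ (x ^ℚ a) * (x ^ℚ b)
  ^ℚ-+ x zero    b = sym (*-identityˡ (x ^ℚ b))
  ^ℚ-+ x (suc a) b = trans (cong (x *_) (^ℚ-+ x a b)) (sym (*-assoc x (x ^ℚ a) (x ^ℚ b)))

  ^ℚ-* : ∀ x a b → x ^ℚ (a ℕ.* b) ≡ (x ^ℚ a) ^ℚ b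
  ^ℚ-* x a zero    rewrite ℕP.*-zeroʳ a = refl
  ^ℚ-* x a (suc b) rewrite ℕP.*-suc a b = trans (^ℚ-+ x a (a ℕ.* b)) (cong ((x ^ℚ a) *_) (^ℚ-* x a b))

  *-nonNeg : ∀ {p q} → 0ℚ ≤ p → 0ℚ ≤ q → 0ℚ ≤ p * q
  *-nonNeg {p} {q} 0≤p 0≤q =
    ≤-trans (≤-reflexive (sym (*-zeroˡ q))) (*-monoʳ-≤-nonNeg q {{ℚ.nonNegative 0≤q}} 0≤p)

  *-mono-≤-nonNeg : ∀ {p q r s} → 0ℚ ≤ p → 0ℚ ≤ r → p ≤ q → r ≤ s → p * r ≤ q * s
  *-mono-≤-nonNeg {p} {q} {r} {s} 0≤p 0≤r p≤q r≤s =
    ≤-trans (*-monoʳ-≤-nonNeg r {{ℚ.nonNegative 0≤r}} p≤q)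
            (*-monoˡ-≤-nonNeg q {{ℚ.nonNegative (≤-trans 0≤p p≤q)}} r≤s)

  p≤2p : ∀ {p} → 0ℚ ≤ p → p ≤ ℕ→ℚ 2 * p
  p≤2p {p} 0≤p = begin
    p           ≡⟨ +-identityʳ p ⟨
    p + 0ℚ      ≤⟨ +-monoʳ-≤ p 0≤p ⟩
    p + p       ≡⟨ solve 1 (λ p → p :+ p := con (ℕ→ℚ 2) :* p) refl p ⟩
    ℕ→ℚ 2 * p  ∎
    where
    open ≤-Reasoning
    open ℚSolver.+-*-Solver

  ^ℚ-nonNeg : ∀ {x} j → 0ℚ ≤ x → 0ℚ ≤ x ^ℚ j
  ^ℚ-nonNeg zero    0≤x = ℕ→ℚ-nonNeg 1
  ^ℚ-nonNeg (suc j) 0≤x = *-nonNeg 0≤x (^ℚ-nonNeg j 0≤x)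

  ^ℚ-monoˡ-≤ : ∀ {x y} j → 0ℚ ≤ x → x ≤ y → x ^ℚ j ≤ y ^ℚ j
  ^ℚ-monoˡ-≤ zero    0≤x x≤y = ≤-refl
  ^ℚ-monoˡ-≤ (suc j) 0≤x x≤y = *-mono-≤-nonNeg 0≤x (^ℚ-nonNeg j 0≤x) x≤y (^ℚ-monoˡ-≤ j 0≤x x≤y)

  ^ℚ-monoʳ-≤ : ∀ {x i j} → 1ℚ ≤ x → i ℕ.≤ j → x ^ℚ i ≤ x ^ℚ j
  ^ℚ-monoʳ-≤ {x} {i} 1≤x i≤j with ℕP.m≤n⇒∃[o]m+o≡n i≤j
  ... | o , refl = begin
    x ^ℚ i               ≡⟨ *-identityʳ (x ^ℚ i) ⟨
    x ^ℚ i * 1ℚ          ≤⟨ *-monoˡ-≤-nonNeg (x ^ℚ i) {{ℚ.nonNegative (^ℚ-nonNeg i 0≤x)}} (1≤^ℚ o) ⟩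
    x ^ℚ i * x ^ℚ o      ≡⟨ ^ℚ-+ x i o ⟨
    x ^ℚ (i ℕ.+ o)       ∎
    where
    open ≤-Reasoning
    0≤x : 0ℚ ≤ x
    0≤x = ≤-trans (ℕ→ℚ-nonNeg 1) 1≤x
    1≤^ℚ : ∀ j → 1ℚ ≤ x ^ℚ j
    1≤^ℚ zero    = ≤-refl
    1≤^ℚ (suc j) = *-mono-≤-nonNeg (ℕ→ℚ-nonNeg 1) (ℕ→ℚ-nonNeg 1) 1≤x (1≤^ℚ j)

  archimedean : ∀ x → ∃[ m ] x < ℕ→ℚ m
  archimedean x@(mkℚ (ℤ.+ p) d c) = suc p , ≤-<-trans x≤p (ℕ→ℚ-mono-< {p} ℕP.≤-refl)
    where
    x≤p : x ≤ ℕ→ℚ p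
    x≤p rewrite ℕ→ℚ≡mkℚ p = ℚ.*≤* (ℤP.*-monoˡ-≤-nonNeg (ℤ.+ p) (ℤ.+≤+ (s≤s z≤n)))
  archimedean x@(mkℚ ℤ.-[1+ p ] d c) = 0 , negative⁻¹ x

  ℕ-floor : ∀ x → 0ℚ ≤ x → ∃[ c ] ℕ→ℚ c ≤ x × x < ℕ→ℚ (suc c)
  ℕ-floor x 0≤x = search (proj₁ (archimedean x)) (proj₂ (archimedean x))
    where
    search : ∀ m → x < ℕ→ℚ m → ∃[ c ] ℕ→ℚ c ≤ x × x < ℕ→ℚ (suc c)
    search zero    x<0 = ⊥-elim (<-irrefl refl (<-≤-trans x<0 0≤x))
    search (suc m) x<1+m with ℕ→ℚ m ≤? x
    ... | yes m≤x = m , m≤x , x<1+m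
    ... | no  m≰x = search m (≰⇒> m≰x)

  ≤-floor : ∀ {x c m} → ℕ→ℚ m ≤ x → x < ℕ→ℚ (suc c) → m ℕ.≤ c
  ≤-floor m≤x x<1+c = ℕP.≤-pred (ℕ→ℚ-cancel-< (≤-<-trans m≤x x<1+c))

  -- With δ = r - 2k² ∈ (0, 1] and u = k - 1 ≥ 0, the gap 2rw - k(k(r + w) + 2r²) equals
  -- S + 2δ + (2r - k²)(w - ℓ), where S is a sum of products of nonnegative factors.
  k[k[r+w]+2r²]<2rw : ∀ {k r w} → 1ℚ ≤ k → ℕ→ℚ 4 * (k ^ℚ 3) + 1ℚ ≤ w →
                      ℕ→ℚ 2 * (k * k) < r → r ≤ ℕ→ℚ 2 * (k * k) + 1ℚ →
                      k * (k * (r + w) + ℕ→ℚ 2 * (r * r)) < ℕ→ℚ 2 * (r * w)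
  k[k[r+w]+2r²]<2rw {k} {r} {w} 1≤k ℓ≤w 2k²<r r≤2k²+1 = begin-strict
    lhs                       ≡⟨ +-identityʳ lhs ⟨
    lhs + 0ℚ                  <⟨ +-monoʳ-< lhs 0<gap ⟩
    lhs + gap                 ≡⟨ gap-identity ⟩
    two * (r * w)             ∎
    where
    open ≤-Reasoning
    open ℚSolver.+-*-Solver
    two lhs ℓ δ u S gap : ℚ
    two = ℕ→ℚ 2
    lhs = k * (k * (r + w) + two * (r * r))
    ℓ = ℕ→ℚ 4 * (k ^ℚ 3) + 1ℚ
    δ = r - two * (k * k)
    u = k - 1ℚ
    S = two * (k * (k * (k * k))) * (1ℚ + two * u) + k * k * (1ℚ - δ)
        + two * k * (1ℚ - δ) * (1ℚ + δ) + two * k * u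
    gap = (S + two * δ) + (two * r - k * k) * (w - ℓ)

    0≤q-p : ∀ {p q} → p ≤ q → 0ℚ ≤ q - p
    0≤q-p {p} {q} p≤q = ≤-trans (≤-reflexive (sym (+-inverseʳ p))) (+-monoˡ-≤ (- p) p≤q)
    0≤k : 0ℚ ≤ k
    0≤k = ≤-trans (ℕ→ℚ-nonNeg 1) 1≤k
    0≤2 : 0ℚ ≤ two
    0≤2 = ℕ→ℚ-nonNeg 2
    0≤1 : 0ℚ ≤ 1ℚ
    0≤1 = ℕ→ℚ-nonNeg 1
    0≤u : 0ℚ ≤ u
    0≤u = 0≤q-p 1≤k
    0<δ : 0ℚ < δ
    0<δ = ≤-<-trans (≤-reflexive (sym (+-inverseʳ (two * (k * k))))) (+-monoˡ-< (- (two * (k * k))) 2k²<r)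
    0≤δ : 0ℚ ≤ δ
    0≤δ = <⇒≤ 0<δ
    0≤1-δ : 0ℚ ≤ 1ℚ - δ
    0≤1-δ = 0≤q-p (≤-trans (+-monoˡ-≤ (- (two * (k * k))) r≤2k²+1)
                           (≤-reflexive (solve 1 (λ k → (con two :* (k :* k) :+ con 1ℚ) :- con two :* (k :* k) := con 1ℚ) refl k)))
    0≤S : 0ℚ ≤ S
    0≤S = +-mono-≤ (+-mono-≤ (+-mono-≤
            (*-nonNeg (*-nonNeg 0≤2 (*-nonNeg 0≤k (*-nonNeg 0≤k (*-nonNeg 0≤k 0≤k)))) (+-mono-≤ 0≤1 (*-nonNeg 0≤2 0≤u)))
            (*-nonNeg (*-nonNeg 0≤k 0≤k) 0≤1-δ))
            (*-nonNeg (*-nonNeg (*-nonNeg 0≤2 0≤k) 0≤1-δ) (+-mono-≤ 0≤1 0≤δ)))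
            (*-nonNeg (*-nonNeg 0≤2 0≤k) 0≤u)
    0≤2r-k² : 0ℚ ≤ two * r - k * k
    0≤2r-k² = ≤-trans (+-mono-≤ (*-nonNeg (ℕ→ℚ-nonNeg 3) (*-nonNeg 0≤k 0≤k)) (*-nonNeg 0≤2 0≤δ))
                (≤-reflexive (solve 2 (λ k r → con (ℕ→ℚ 3) :* (k :* k) :+ con two :* (r :- con two :* (k :* k))
                                               := con two :* r :- k :* k) refl k r))
    0<gap : 0ℚ < gap
    0<gap = +-mono-<-≤ (+-mono-≤-< 0≤S (*-monoʳ-<-pos two 0<δ)) (*-nonNeg 0≤2r-k² (0≤q-p ℓ≤w))
    gap-identity : lhs + gap ≡ two * (r * w)
    gap-identity = solve 3 (λ k r w →
      k :* (k :* (r :+ w) :+ con two :* (r :* r)) :+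
        ((con two :* (k :* (k :* (k :* k))) :* (con 1ℚ :+ con two :* (k :- con 1ℚ))
          :+ k :* k :* (con 1ℚ :- (r :- con two :* (k :* k)))
          :+ con two :* k :* (con 1ℚ :- (r :- con two :* (k :* k))) :* (con 1ℚ :+ (r :- con two :* (k :* k)))
          :+ con two :* k :* (k :- con 1ℚ)
          :+ con two :* (r :- con two :* (k :* k)))
         :+ (con two :* r :- k :* k) :* (w :- (con (ℕ→ℚ 4) :* (k :* (k :* (k :* con 1ℚ))) :+ con 1ℚ)))
      := con two :* (r :* w)) refl k r w

  LeRatPow-intro : ∀ {x y r} e → 0ℚ ≤ x → 1ℚ ≤ y → x ≤ y ^ℚ e → ℕ→ℚ e ≤ r → LeRatPow x y r
  LeRatPow-intro {x} {y} {r} e 0≤x 1≤y x≤yᵉ e≤r p d _ p≡rd = begin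
    x ^ℚ d         ≤⟨ ^ℚ-monoˡ-≤ d 0≤x x≤yᵉ ⟩
    (y ^ℚ e) ^ℚ d  ≡⟨ ^ℚ-* y e d ⟨
    y ^ℚ (e ℕ.* d) ≤⟨ ^ℚ-monoʳ-≤ 1≤y ed≤p ⟩
    y ^ℚ p         ∎
    where
    open ≤-Reasoning
    ed≤p : e ℕ.* d ℕ.≤ p
    ed≤p = ℕ→ℚ-cancel-≤ (begin
      ℕ→ℚ (e ℕ.* d)   ≡⟨ ℕ→ℚ-* e d ⟩
      ℕ→ℚ e * ℕ→ℚ d   ≤⟨ *-monoʳ-≤-nonNeg (ℕ→ℚ d) {{ℚ.nonNegative (ℕ→ℚ-nonNeg d)}} e≤r ⟩
      r * ℕ→ℚ d       ≡⟨ p≡rd ⟨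
      ℕ→ℚ p           ∎)

  LeRatPow-0 : ∀ {y r} → 0ℚ ≤ y → LeRatPow 0ℚ y r
  LeRatPow-0 0≤y p (suc d) _ _ = ≤-trans (≤-reflexive (*-zeroˡ (0ℚ ^ℚ d))) (^ℚ-nonNeg p 0≤y)

  k[2k²]^j≤[2k]^[2j+1] : ∀ {k} j → 0ℚ ≤ k → k * (ℕ→ℚ 2 * (k * k)) ^ℚ j ≤ (ℕ→ℚ 2 * k) ^ℚ suc (j ℕ.+ j)
  k[2k²]^j≤[2k]^[2j+1] {k} zero    0≤k = *-monoʳ-≤-nonNeg 1ℚ {{ℚ.nonNegative (ℕ→ℚ-nonNeg 1)}} (p≤2p 0≤k)
  k[2k²]^j≤[2k]^[2j+1] {k} (suc j) 0≤k rewrite ℕP.+-suc j j = begin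
    k * (t * t ^ℚ j)              ≡⟨ solve 3 (λ k t x → k :* (t :* x) := t :* (k :* x)) refl k t (t ^ℚ j) ⟩
    t * (k * t ^ℚ j)              ≤⟨ *-mono-≤-nonNeg 0≤t (*-nonNeg 0≤k (^ℚ-nonNeg j 0≤t)) t≤y² (k[2k²]^j≤[2k]^[2j+1] j 0≤k) ⟩
    (y * y) * y ^ℚ suc (j ℕ.+ j)  ≡⟨ *-assoc y y _ ⟩
    y ^ℚ suc (suc (suc (j ℕ.+ j))) ∎
    where
    open ≤-Reasoning
    open ℚSolver.+-*-Solver
    t y : ℚ
    t = ℕ→ℚ 2 * (k * k)
    y = ℕ→ℚ 2 * k
    0≤t : 0ℚ ≤ t
    0≤t = *-nonNeg (ℕ→ℚ-nonNeg 2) (*-nonNeg 0≤k 0≤k)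
    t≤y² : t ≤ y * y
    t≤y² = ≤-trans (p≤2p 0≤t) (≤-reflexive (solve 1 (λ k → con (ℕ→ℚ 2) :* (con (ℕ→ℚ 2) :* (k :* k))
                                                  := (con (ℕ→ℚ 2) :* k) :* (con (ℕ→ℚ 2) :* k)) refl k))

  m≤m^[1+n] : ∀ m n → m ℕ.≤ m ℕ.^ suc n
  m≤m^[1+n] zero    n = z≤n
  m≤m^[1+n] (suc m) n = ℕP.≤-trans (ℕP.≤-reflexive (sym (ℕP.*-identityʳ (suc m)))) (ℕP.*-monoʳ-≤ (suc m) (ℕP.m^n>0 (suc m) n))

  K*c^K≤[2k]^[2K+1] : ∀ {k} c K → 0ℚ ≤ k → ℕ→ℚ c ≤ ℕ→ℚ 2 * (k * k) → ℕ→ℚ K ≤ k →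
                      ℕ→ℚ (K ℕ.* c ℕ.^ K) ≤ (ℕ→ℚ 2 * k) ^ℚ suc (K ℕ.+ K)
  K*c^K≤[2k]^[2K+1] {k} c K 0≤k c≤2k² K≤k = begin
    ℕ→ℚ (K ℕ.* c ℕ.^ K)            ≡⟨ trans (ℕ→ℚ-* K (c ℕ.^ K)) (cong (ℕ→ℚ K *_) (ℕ→ℚ-^ c K)) ⟩
    ℕ→ℚ K * ℕ→ℚ c ^ℚ K             ≤⟨ *-mono-≤-nonNeg (ℕ→ℚ-nonNeg K) (^ℚ-nonNeg K (ℕ→ℚ-nonNeg c)) K≤k
                                        (^ℚ-monoˡ-≤ K (ℕ→ℚ-nonNeg c) c≤2k²) ⟩
    k * (ℕ→ℚ 2 * (k * k)) ^ℚ K     ≤⟨ k[2k²]^j≤[2k]^[2j+1] K 0≤k ⟩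
    (ℕ→ℚ 2 * k) ^ℚ suc (K ℕ.+ K)   ∎
    where open ≤-Reasoning

  m≤K*c^K⇒m≤[2k]^[2k+1] : ∀ {k m} c K → 0ℚ ≤ k → ℕ→ℚ c ≤ ℕ→ℚ 2 * (k * k) → ℕ→ℚ K ≤ k →
                           m ℕ.≤ K ℕ.* c ℕ.^ K → LeRatPow (ℕ→ℚ m) (ℕ→ℚ 2 * k) (ℕ→ℚ 2 * k + 1ℚ)
  m≤K*c^K⇒m≤[2k]^[2k+1] {k} {zero} c K 0≤k c≤2k² K≤k _ = LeRatPow-0 {r = ℕ→ℚ 2 * k + 1ℚ} (*-nonNeg (ℕ→ℚ-nonNeg 2) 0≤k)
  m≤K*c^K⇒m≤[2k]^[2k+1] {k} {suc m} c K 0≤k c≤2k² K≤k m<K*c^K =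
    LeRatPow-intro {r = ℕ→ℚ 2 * k + 1ℚ} (suc (K ℕ.+ K)) (ℕ→ℚ-nonNeg (suc m)) 1≤2k
      (≤-trans (ℕ→ℚ-mono-≤ m<K*c^K) (K*c^K≤[2k]^[2K+1] c K 0≤k c≤2k² K≤k)) 1+2K≤2k+1
    where
    open ≤-Reasoning
    open ℚSolver.+-*-Solver
    1≤K : 1 ℕ.≤ K
    1≤K = ℕ.>-nonZero⁻¹ K {{ℕP.m*n≢0⇒m≢0 K {c ℕ.^ K} {{ℕ.>-nonZero (ℕP.<-≤-trans (s≤s z≤n) m<K*c^K)}}}}
    1≤2k : 1ℚ ≤ ℕ→ℚ 2 * k
    1≤2k = ≤-trans (ℕ→ℚ-mono-≤ 1≤K) (≤-trans K≤k (p≤2p 0≤k))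
    1+2K≤2k+1 : ℕ→ℚ (suc (K ℕ.+ K)) ≤ ℕ→ℚ 2 * k + 1ℚ
    1+2K≤2k+1 = begin
      ℕ→ℚ (suc (K ℕ.+ K))       ≡⟨ trans (ℕ→ℚ-suc (K ℕ.+ K)) (cong (1ℚ +_) (ℕ→ℚ-+ K K)) ⟩
      1ℚ + (ℕ→ℚ K + ℕ→ℚ K)      ≤⟨ +-monoʳ-≤ 1ℚ (+-mono-≤ K≤k K≤k) ⟩
      1ℚ + (k + k)              ≡⟨ solve 1 (λ k → con 1ℚ :+ (k :+ k) := con (ℕ→ℚ 2) :* k :+ con 1ℚ) refl k ⟩
      ℕ→ℚ 2 * k + 1ℚ            ∎

  countᵇ : ∀ {A : Set} → (A → Bool) → List A → ℕ
  countᵇ p []       = 0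
  countᵇ p (x ∷ xs) = (if p x then 1 else 0) ℕ.+ countᵇ p xs

  countᵇ-map : ∀ {A B : Set} (p : B → Bool) (f : A → B) xs → countᵇ p (map f xs) ≡ countᵇ (p ∘ f) xs
  countᵇ-map p f []       = refl
  countᵇ-map p f (x ∷ xs) = cong ((if p (f x) then 1 else 0) ℕ.+_) (countᵇ-map p f xs)

  countᵇ-++ : ∀ {A : Set} (p : A → Bool) xs ys → countᵇ p (xs ++ ys) ≡ countᵇ p xs ℕ.+ countᵇ p ys
  countᵇ-++ p []       ys = refl
  countᵇ-++ p (x ∷ xs) ys = trans (cong ((if p x then 1 else 0) ℕ.+_) (countᵇ-++ p xs ys))
                                  (sym (ℕP.+-assoc (if p x then 1 else 0) (countᵇ p xs) (countᵇ p ys)))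

  countFin∘lookup : ∀ {A : Set} (p : A → Bool) (xs : List A) →
                    countFin (λ i → p (Data.List.lookup xs i)) ≡ countᵇ p xs
  countFin∘lookup p []       = refl
  countFin∘lookup p (x ∷ xs) = cong ((if p x then 1 else 0) ℕ.+_) (countFin∘lookup p xs)

  sum-map-+ : ∀ {A : Set} (f : A → ℕ) r xs → sum (map (λ x → f x ℕ.+ r) xs) ≡ sum (map f xs) ℕ.+ length xs ℕ.* r
  sum-map-+ f r []       = refl
  sum-map-+ f r (x ∷ xs) = begin
    f x ℕ.+ r ℕ.+ sum (map (λ x → f x ℕ.+ r) xs)    ≡⟨ cong (f x ℕ.+ r ℕ.+_) (sum-map-+ f r xs) ⟩
    f x ℕ.+ r ℕ.+ (sum (map f xs) ℕ.+ length xs ℕ.* r) ≡⟨ solve 4 (λ a b c d →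
        a :+ b :+ (c :+ d :* b) := a :+ c :+ (b :+ d :* b)) refl (f x) r (sum (map f xs)) (length xs) ⟩
    f x ℕ.+ sum (map f xs) ℕ.+ (r ℕ.+ length xs ℕ.* r) ∎
    where
    open ≡-Reasoning
    open ℕSolver.+-*-Solver

  length*≤*sum : ∀ {A : Set} (k : ℚ) (a : ℕ) (g : A → ℕ) xs → (∀ x → x ∈ˡ xs → ℕ→ℚ a ≤ k * ℕ→ℚ (g x)) →
                 ℕ→ℚ (length xs ℕ.* a) ≤ k * ℕ→ℚ (sum (map g xs))
  length*≤*sum k a g []       h = ≤-reflexive (sym (*-zeroʳ k))
  length*≤*sum k a g (x ∷ xs) h = begin
    ℕ→ℚ (a ℕ.+ length xs ℕ.* a)              ≡⟨ ℕ→ℚ-+ a (length xs ℕ.* a) ⟩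
    ℕ→ℚ a + ℕ→ℚ (length xs ℕ.* a)            ≤⟨ +-mono-≤ (h x (here refl)) (length*≤*sum k a g xs (λ y y∈xs → h y (there y∈xs))) ⟩
    k * ℕ→ℚ (g x) + k * ℕ→ℚ (sum (map g xs)) ≡⟨ *-distribˡ-+ k (ℕ→ℚ (g x)) (ℕ→ℚ (sum (map g xs))) ⟨
    k * (ℕ→ℚ (g x) + ℕ→ℚ (sum (map g xs)))   ≡⟨ cong (k *_) (ℕ→ℚ-+ (g x) (sum (map g xs))) ⟨
    k * ℕ→ℚ (g x ℕ.+ sum (map g xs))         ∎
    where open ≤-Reasoning

  lookup-injective : ∀ {A : Set} (xs : List A) → Unique xs → ∀ i j → Data.List.lookup xs i ≡ Data.List.lookup xs j → i ≡ j
  lookup-injective (x ∷ xs) u          fzero    fzero    eq = refl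
  lookup-injective (x ∷ xs) (x∉ ∷ u)   fzero    (fsuc j) eq = ⊥-elim (All.lookup x∉ (∈ˡP.∈-lookup j) eq)
  lookup-injective (x ∷ xs) (x∉ ∷ u)   (fsuc i) fzero    eq = ⊥-elim (All.lookup x∉ (∈ˡP.∈-lookup i) (sym eq))
  lookup-injective (x ∷ xs) (x∉ ∷ u)   (fsuc i) (fsuc j) eq = cong fsuc (lookup-injective xs u i j eq)

  toList : ∀ {m} → Subset m → List (Fin m)
  toList []          = []
  toList (true ∷ p)  = fzero ∷ map fsuc (toList p)
  toList (false ∷ p) = map fsuc (toList p)

  ∈-toList⁻ : ∀ {m} {x : Fin m} (p : Subset m) → x ∈ˡ toList p → x ∈ p
  ∈-toList⁻ (true ∷ p) (here refl) = here
  ∈-toList⁻ (true ∷ p) (there x∈) with ∈ˡP.∈-map⁻ fsuc x∈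
  ... | y , y∈ , refl = there (∈-toList⁻ p y∈)
  ∈-toList⁻ (false ∷ p) x∈ with ∈ˡP.∈-map⁻ fsuc x∈
  ... | y , y∈ , refl = there (∈-toList⁻ p y∈)

  toList-unique : ∀ {m} (p : Subset m) → Unique (toList p)
  toList-unique []          = []
  toList-unique (true ∷ p)  = All.tabulate 0∉ ∷ UniqueP.map⁺ FinP.suc-injective (toList-unique p)
    where
    0∉ : ∀ {x} → x ∈ˡ map fsuc (toList p) → fzero ≢ x
    0∉ x∈ refl with ∈ˡP.∈-map⁻ fsuc x∈
    ... | _ , _ , ()
  toList-unique (false ∷ p) = UniqueP.map⁺ FinP.suc-injective (toList-unique p)

  length-toList : ∀ {m} (p : Subset m) → length (toList p) ≡ ∣ p ∣
  length-toList []          = refl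
  length-toList (true ∷ p)  = cong suc (trans (ListP.length-map fsuc (toList p)) (length-toList p))
  length-toList (false ∷ p) = trans (ListP.length-map fsuc (toList p)) (length-toList p)

  countᵇ-toList : ∀ {m} (f : Fin m → Bool) (p : Subset m) → countᵇ f (toList p) ≡ ∣ tabulate f ∩ p ∣
  countᵇ-toList f []          = refl
  countᵇ-toList f (true ∷ p)  with f fzero
  ... | true  = cong suc (trans (countᵇ-map f fsuc (toList p)) (countᵇ-toList (f ∘ fsuc) p))
  ... | false = trans (countᵇ-map f fsuc (toList p)) (countᵇ-toList (f ∘ fsuc) p)
  countᵇ-toList f (false ∷ p) with f fzero
  ... | true  = trans (countᵇ-map f fsuc (toList p)) (countᵇ-toList (f ∘ fsuc) p)
  ... | false = trans (countᵇ-map f fsuc (toList p)) (countᵇ-toList (f ∘ fsuc) p)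

  ∣p∪q∣≤∣p∣+∣q∣ : ∀ {m} (p q : Subset m) → ∣ p ∪ q ∣ ℕ.≤ ∣ p ∣ ℕ.+ ∣ q ∣
  ∣p∪q∣≤∣p∣+∣q∣ []          []          = z≤n
  ∣p∪q∣≤∣p∣+∣q∣ (true ∷ p)  (true ∷ q)  = s≤s (ℕP.≤-trans (ℕP.n≤1+n _) (ℕP.≤-trans
                                            (s≤s (∣p∪q∣≤∣p∣+∣q∣ p q)) (ℕP.≤-reflexive (sym (ℕP.+-suc ∣ p ∣ ∣ q ∣)))))
  ∣p∪q∣≤∣p∣+∣q∣ (true ∷ p)  (false ∷ q) = s≤s (∣p∪q∣≤∣p∣+∣q∣ p q)
  ∣p∪q∣≤∣p∣+∣q∣ (false ∷ p) (true ∷ q)  = ℕP.≤-trans (s≤s (∣p∪q∣≤∣p∣+∣q∣ p q)) (ℕP.≤-reflexive (sym (ℕP.+-suc ∣ p ∣ ∣ q ∣)))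
  ∣p∪q∣≤∣p∣+∣q∣ (false ∷ p) (false ∷ q) = ∣p∪q∣≤∣p∣+∣q∣ p q

  ⋃∈ : ∀ {m m′} → Subset m → (Fin m → Subset m′) → Subset m′
  ⋃∈ []          F = ⊥
  ⋃∈ (true ∷ C)  F = F fzero ∪ ⋃∈ C (F ∘ fsuc)
  ⋃∈ (false ∷ C) F = ⋃∈ C (F ∘ fsuc)

  syntax ⋃∈ C (λ z → F) = ⋃[ z ∈ C ] F

  ∈-⋃∈⁺ : ∀ {m m′} (C : Subset m) (F : Fin m → Subset m′) {z x} → z ∈ C → x ∈ F z → x ∈ ⋃∈ C F
  ∈-⋃∈⁺ (true ∷ C)  F here      x∈ = SubsetP.p⊆p∪q (⋃∈ C (F ∘ fsuc)) x∈
  ∈-⋃∈⁺ (true ∷ C)  F (there z∈) x∈ = SubsetP.q⊆p∪q (F fzero) (⋃∈ C (F ∘ fsuc)) (∈-⋃∈⁺ C (F ∘ fsuc) z∈ x∈)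
  ∈-⋃∈⁺ (false ∷ C) F (there z∈) x∈ = ∈-⋃∈⁺ C (F ∘ fsuc) z∈ x∈

  ∣⋃∈∣≤ : ∀ {m m′} (C : Subset m) (F : Fin m → Subset m′) b → (∀ z → z ∈ C → ∣ F z ∣ ℕ.≤ b) → ∣ ⋃∈ C F ∣ ℕ.≤ ∣ C ∣ ℕ.* b
  ∣⋃∈∣≤ {m′ = m′} [] F b h = ℕP.≤-reflexive (SubsetP.∣⊥∣≡0 m′)
  ∣⋃∈∣≤ (true ∷ C)  F b h = ℕP.≤-trans (∣p∪q∣≤∣p∣+∣q∣ (F fzero) (⋃∈ C (F ∘ fsuc)))
    (ℕP.+-mono-≤ (h fzero here) (∣⋃∈∣≤ C (F ∘ fsuc) b (λ z z∈ → h (fsuc z) (there z∈))))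
  ∣⋃∈∣≤ (false ∷ C) F b h = ∣⋃∈∣≤ C (F ∘ fsuc) b (λ z z∈ → h (fsuc z) (there z∈))

  ⊆-of-size : ∀ {m} r (p : Subset m) → r ℕ.≤ ∣ p ∣ → ∃[ q ] q ⊆ p × ∣ q ∣ ≡ r
  ⊆-of-size {m} zero p r≤ = ⊥ , (λ x∈⊥ → ⊥-elim (SubsetP.∉⊥ x∈⊥)) , SubsetP.∣⊥∣≡0 m
  ⊆-of-size (suc r) (true ∷ p)  (s≤s r≤) with ⊆-of-size r p r≤
  ... | q , q⊆p , ∣q∣≡r = true ∷ q , (λ { here → here ; (there x∈) → there (q⊆p x∈) }) , cong suc ∣q∣≡r
  ⊆-of-size (suc r) (false ∷ p) r≤ with ⊆-of-size (suc r) p r≤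
  ... | q , q⊆p , ∣q∣≡r = false ∷ q , (λ { (there x∈) → there (q⊆p x∈) }) , ∣q∣≡r

  ∣p∣>0⇒Nonempty : ∀ {m} (p : Subset m) → 0 ℕ.< ∣ p ∣ → Nonempty p
  ∣p∣>0⇒Nonempty (true ∷ p)  _   = fzero , here
  ∣p∣>0⇒Nonempty (false ∷ p) ∣p∣>0 with ∣p∣>0⇒Nonempty p ∣p∣>0
  ... | x , x∈p = fsuc x , there x∈p

  subsetOf : ∀ {m} {P : Fin m → Set} → (∀ x → Dec (P x)) → Subset m
  subsetOf P? = tabulate (λ x → does (P? x))

  ∈-subsetOf⁺ : ∀ {m} {P : Fin m → Set} (P? : ∀ x → Dec (P x)) {x} → P x → x ∈ subsetOf P?
  ∈-subsetOf⁺ {P = P} P? {x} px = VecP.lookup⇒[]= x _ (trans (VecP.lookup∘tabulate (does ∘ P?) x) (does-yes (P? x)))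
    where
    does-yes : (d : Dec (P x)) → does d ≡ true
    does-yes (yes _)  = refl
    does-yes (no ¬px) = ⊥-elim (¬px px)

  ∈-subsetOf⁻ : ∀ {m} {P : Fin m → Set} (P? : ∀ x → Dec (P x)) {x} → x ∈ subsetOf P? → P x
  ∈-subsetOf⁻ {P = P} P? {x} x∈ = witness (P? x) (trans (sym (VecP.lookup∘tabulate (does ∘ P?) x)) (VecP.[]=⇒lookup x∈))
    where
    witness : (d : Dec (P x)) → does d ≡ true → P x
    witness (yes px) _  = px
    witness (no _)   ()

  anyFin-cong : ∀ {m} {f g : Fin m → Bool} → (∀ i → f i ≡ g i) → anyFin f ≡ anyFin g
  anyFin-cong {zero}  f≗g = refl
  anyFin-cong {suc m} f≗g = cong₂ _∨_ (f≗g fzero) (anyFin-cong (f≗g ∘ fsuc))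

  countFin-cong : ∀ {m} {f g : Fin m → Bool} → (∀ i → f i ≡ g i) → countFin f ≡ countFin g
  countFin-cong {zero}  f≗g = refl
  countFin-cong {suc m} f≗g = cong₂ ℕ._+_ (cong (λ b → if b then 1 else 0) (f≗g fzero)) (countFin-cong (f≗g ∘ fsuc))

  sumFin-cong : ∀ {m} {f g : Fin m → ℕ} → (∀ i → f i ≡ g i) → sumFin f ≡ sumFin g
  sumFin-cong {zero}  f≗g = refl
  sumFin-cong {suc m} f≗g = cong₂ ℕ._+_ (f≗g fzero) (sumFin-cong (f≗g ∘ fsuc))

  anyFin-false : ∀ m → anyFin {m} (λ _ → false) ≡ false
  anyFin-false zero    = refl
  anyFin-false (suc m) = anyFin-false m

  anyFin-∧ˡ : ∀ {m} b (f : Fin m → Bool) → anyFin (λ i → b ∧ f i) ≡ b ∧ anyFin f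
  anyFin-∧ˡ {m} false f = anyFin-false m
  anyFin-∧ˡ     true  f = refl

  anyFin-⁅⁆ : ∀ {m} (c : Fin m) (f : Fin m → Bool) → anyFin (λ i → lookup ⁅ c ⁆ i ∧ f i) ≡ f c
  anyFin-⁅⁆ {suc m} fzero    f = trans (cong (f fzero ∨_) rest-false) (BoolP.∨-identityʳ (f fzero))
    where
    rest-false : anyFin (λ i → lookup (Data.Vec.replicate m false) i ∧ f (fsuc i)) ≡ false
    rest-false = trans (anyFin-cong (λ i → cong (_∧ f (fsuc i)) (VecP.lookup-replicate i false))) (anyFin-false m)
  anyFin-⁅⁆ {suc m} (fsuc c) f = anyFin-⁅⁆ c (f ∘ fsuc)

  module _ (G : Graph) where

    private
      V : Set
      V = Fin (n G)

    edgesAmong : List V → ℕ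
    edgesAmong []       = 0
    edgesAmong (x ∷ xs) = countᵇ (adj G x) xs ℕ.+ edgesAmong xs

    singletonMinor : (xs : List V) → Unique xs → ShallowMinor₁ G
    singletonMinor xs xs! = record
      { m        = length xs
      ; branch   = λ a → ⁅ x a ⁆
      ; disjoint = λ a b a≢b y y∈a y∈b → a≢b (lookup-injective xs xs! a b
                     (trans (sym (SubsetP.x∈⁅y⁆⇒x≡y _ y∈a)) (SubsetP.x∈⁅y⁆⇒x≡y _ y∈b)))
      ; centre   = x
      ; centre∈  = λ a → SubsetP.x∈⁅x⁆ (x a)
      ; radius₁  = λ a → SubsetP.q⊆p∪q (N G (x a)) ⁅ x a ⁆
      }
      where
      x : Fin (length xs) → V
      x = Data.List.lookup xs

    singletonMinor-edges : ∀ xs xs! → ShallowMinor₁.edges (singletonMinor xs xs!) ≡ edgesAmong xs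
    singletonMinor-edges xs xs! =
      trans (sumFin-cong (λ a → countFin-cong (λ b → cong ((toℕ a ℕ.<ᵇ toℕ b) ∧_) (adjH≡adj a b))))
            (edgesAmong-lookup xs)
      where
      x : Fin (length xs) → V
      x = Data.List.lookup xs
      adjH≡adj : ∀ a b → ShallowMinor₁.adjH (singletonMinor xs xs!) a b ≡ adj G (x a) (x b)
      adjH≡adj a b = begin
        anyFin (λ y → anyFin (λ z → lookup ⁅ x a ⁆ y ∧ lookup ⁅ x b ⁆ z ∧ adj G y z))
          ≡⟨ anyFin-cong (λ y → anyFin-∧ˡ (lookup ⁅ x a ⁆ y) (λ z → lookup ⁅ x b ⁆ z ∧ adj G y z)) ⟩
        anyFin (λ y → lookup ⁅ x a ⁆ y ∧ anyFin (λ z → lookup ⁅ x b ⁆ z ∧ adj G y z))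
          ≡⟨ anyFin-⁅⁆ (x a) (λ y → anyFin (λ z → lookup ⁅ x b ⁆ z ∧ adj G y z)) ⟩
        anyFin (λ z → lookup ⁅ x b ⁆ z ∧ adj G (x a) z)
          ≡⟨ anyFin-⁅⁆ (x b) (adj G (x a)) ⟩
        adj G (x a) (x b) ∎
        where open ≡-Reasoning
      edgesAmong-lookup : ∀ ys → sumFin (λ a → countFin (λ b →
                            (toℕ a ℕ.<ᵇ toℕ b) ∧ adj G (Data.List.lookup ys a) (Data.List.lookup ys b)))
                          ≡ edgesAmong ys
      edgesAmong-lookup []       = refl
      edgesAmong-lookup (y ∷ ys) = cong₂ ℕ._+_ (countFin∘lookup (adj G y) ys) (edgesAmong-lookup ys)

    edgesAmong≤∇*length : ∀ nabla → IsNabla₁ G nabla → ∀ xs → Unique xs → 0 ℕ.< length xs →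
                          ℕ→ℚ (edgesAmong xs) ≤ nabla * ℕ→ℚ (length xs)
    edgesAmong≤∇*length nabla (bound , _) xs xs! xs≢[] =
      subst (λ e → ℕ→ℚ e ≤ nabla * ℕ→ℚ (length xs)) (singletonMinor-edges xs xs!) (bound (singletonMinor xs xs!) xs≢[])

    crossEdges : List V → List V → ℕ
    crossEdges zs ws = sum (map (λ z → countᵇ (adj G z) ws) zs)

    crossEdges≤edgesAmong-++ : ∀ zs ws → crossEdges zs ws ℕ.≤ edgesAmong (zs ++ ws)
    crossEdges≤edgesAmong-++ []       ws = z≤n
    crossEdges≤edgesAmong-++ (z ∷ zs) ws = ℕP.+-mono-≤
      (ℕP.≤-trans (ℕP.m≤n+m (countᵇ (adj G z) ws) (countᵇ (adj G z) zs))
                  (ℕP.≤-reflexive (sym (countᵇ-++ (adj G z) zs ws))))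
      (crossEdges≤edgesAmong-++ zs ws)

    ∣N[z]∩W∣≤∣Nz∩[W∖Z]∣+∣Z∣ : ∀ {W Z : Subset (n G)} {z} → z ∈ Z →
                               ∣ N[_] G z ∩ W ∣ ℕ.≤ ∣ N G z ∩ (W ∖ Z) ∣ ℕ.+ ∣ Z ∣
    ∣N[z]∩W∣≤∣Nz∩[W∖Z]∣+∣Z∣ {W} {Z} {z} z∈Z =
      ℕP.≤-trans (SubsetP.p⊆q⇒∣p∣≤∣q∣ split) (∣p∪q∣≤∣p∣+∣q∣ (N G z ∩ (W ∖ Z)) Z)
      where
      split : N[_] G z ∩ W ⊆ (N G z ∩ (W ∖ Z)) ∪ Z
      split {x} x∈ with SubsetP.x∈p∩q⁻ (N[_] G z) W x∈ | x SubsetP.∈? Z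
      ... | _         , _   | yes x∈Z = SubsetP.q⊆p∪q _ Z x∈Z
      ... | x∈N[z] , x∈W | no  x∉Z with SubsetP.x∈p∪q⁻ (N G z) ⁅ z ⁆ x∈N[z]
      ...   | inj₁ x∈Nz = SubsetP.p⊆p∪q Z (SubsetP.x∈p∩q⁺ (x∈Nz , SubsetP.x∈p∩q⁺ (x∈W , SubsetP.x∉p⇒x∈∁p x∉Z)))
      ...   | inj₂ x≡z  = ⊥-elim (x∉Z (subst (_∈ Z) (sym (SubsetP.x∈⁅y⁆⇒x≡y z x≡z)) z∈Z))

    ∇-nonNeg : ∀ nabla → IsNabla₁ G nabla → 0ℚ ≤ nabla
    ∇-nonNeg nabla (_ , H , 0<m , edges≡) =
      *-cancelʳ-≤-pos (ℕ→ℚ m) {{ℚ.positive (ℕ→ℚ-mono-< {0} 0<m)}}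
        (≤-trans (≤-reflexive (*-zeroˡ (ℕ→ℚ m))) (≤-trans (ℕ→ℚ-nonNeg (ShallowMinor₁.edges H)) (≤-reflexive edges≡)))
      where
      m : ℕ
      m = ShallowMinor₁.m H

  module _ (G : Graph) (nabla : ℚ) (∇₁ : IsNabla₁ G nabla) where

    k : ℚ
    k = ℕ→ℚ 2 * nabla

    open Params G k

    0≤k : 0ℚ ≤ k
    0≤k = *-nonNeg (ℕ→ℚ-nonNeg 2) (∇-nonNeg G nabla ∇₁)

    0≤2k² : 0ℚ ≤ ℕ→ℚ 2 * (k * k)
    0≤2k² = *-nonNeg (ℕ→ℚ-nonNeg 2) (*-nonNeg 0≤k 0≤k)

    k*-mono-≤ : ∀ {p q} → p ≤ q → k * p ≤ k * q
    k*-mono-≤ = *-monoˡ-≤-nonNeg k {{ℚ.nonNegative 0≤k}}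

    Admissible : Subset (n G) → Fin (n G) → Set
    Admissible W z = Strong z W × ℓ ≤ ℕ→ℚ ∣ N[_] G z ∩ W ∣

    admissible? : ∀ W z → Dec (Admissible W z)
    admissible? W z = (ℕ→ℚ ∣ W ∣ ≤? k * ℕ→ℚ ∣ N[_] G z ∩ W ∣) ×-dec (ℓ ≤? ℕ→ℚ ∣ N[_] G z ∩ W ∣)

    admissible : Subset (n G) → Subset (n G)
    admissible W = subsetOf (admissible? W)

    rw≤k[e+r²] : ∀ W Z → Z ⊆ admissible W →
                 ℕ→ℚ (∣ Z ∣ ℕ.* ∣ W ∣) ≤ k * ℕ→ℚ (crossEdges G (toList Z) (toList (W ∖ Z)) ℕ.+ ∣ Z ∣ ℕ.* ∣ Z ∣)
    rw≤k[e+r²] W Z Z⊆ = begin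
      ℕ→ℚ (∣ Z ∣ ℕ.* ∣ W ∣)                                ≡⟨ cong (λ r → ℕ→ℚ (r ℕ.* ∣ W ∣)) (length-toList Z) ⟨
      ℕ→ℚ (length zs ℕ.* ∣ W ∣)                            ≤⟨ length*≤*sum k ∣ W ∣ (λ z → degree z ℕ.+ ∣ Z ∣) zs ∣W∣≤k*[degree+∣Z∣] ⟩
      k * ℕ→ℚ (sum (map (λ z → degree z ℕ.+ ∣ Z ∣) zs))    ≡⟨ cong (λ x → k * ℕ→ℚ x) (sum-map-+ degree ∣ Z ∣ zs) ⟩
      k * ℕ→ℚ (crossEdges G zs ws ℕ.+ length zs ℕ.* ∣ Z ∣) ≡⟨ cong (λ r → k * ℕ→ℚ (crossEdges G zs ws ℕ.+ r ℕ.* ∣ Z ∣)) (length-toList Z) ⟩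
      k * ℕ→ℚ (crossEdges G zs ws ℕ.+ ∣ Z ∣ ℕ.* ∣ Z ∣)     ∎
      where
      open ≤-Reasoning
      zs ws : List (Fin (n G))
      zs = toList Z
      ws = toList (W ∖ Z)
      degree : Fin (n G) → ℕ
      degree z = countᵇ (adj G z) ws
      ∣W∣≤k*[degree+∣Z∣] : ∀ z → z ∈ˡ zs → ℕ→ℚ ∣ W ∣ ≤ k * ℕ→ℚ (degree z ℕ.+ ∣ Z ∣)
      ∣W∣≤k*[degree+∣Z∣] z z∈zs = begin
        ℕ→ℚ ∣ W ∣                                ≤⟨ proj₁ (∈-subsetOf⁻ (admissible? W) (Z⊆ z∈Z)) ⟩
        k * ℕ→ℚ ∣ N[_] G z ∩ W ∣                  ≤⟨ k*-mono-≤ (ℕ→ℚ-mono-≤ (∣N[z]∩W∣≤∣Nz∩[W∖Z]∣+∣Z∣ G z∈Z)) ⟩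
        k * ℕ→ℚ (∣ N G z ∩ (W ∖ Z) ∣ ℕ.+ ∣ Z ∣)   ≡⟨ cong (λ d → k * ℕ→ℚ (d ℕ.+ ∣ Z ∣)) (countᵇ-toList (adj G z) (W ∖ Z)) ⟨
        k * ℕ→ℚ (degree z ℕ.+ ∣ Z ∣)              ∎
        where
        z∈Z : z ∈ Z
        z∈Z = ∈-toList⁻ Z z∈zs

    e≤∇[r+w] : ∀ W Z → 0 ℕ.< ∣ Z ∣ →
               ℕ→ℚ (crossEdges G (toList Z) (toList (W ∖ Z))) ≤ nabla * (ℕ→ℚ ∣ Z ∣ + ℕ→ℚ ∣ W ∣)
    e≤∇[r+w] W Z 0<∣Z∣ = begin
      ℕ→ℚ (crossEdges G zs ws)           ≤⟨ ℕ→ℚ-mono-≤ (crossEdges≤edgesAmong-++ G zs ws) ⟩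
      ℕ→ℚ (edgesAmong G (zs ++ ws))      ≤⟨ edgesAmong≤∇*length G nabla ∇₁ (zs ++ ws) unique 0<length ⟩
      nabla * ℕ→ℚ (length (zs ++ ws))    ≤⟨ *-monoˡ-≤-nonNeg nabla {{ℚ.nonNegative (∇-nonNeg G nabla ∇₁)}}
                                              (ℕ→ℚ-mono-≤ length≤) ⟩
      nabla * ℕ→ℚ (∣ Z ∣ ℕ.+ ∣ W ∣)      ≡⟨ cong (nabla *_) (ℕ→ℚ-+ ∣ Z ∣ ∣ W ∣) ⟩
      nabla * (ℕ→ℚ ∣ Z ∣ + ℕ→ℚ ∣ W ∣)    ∎
      where
      open ≤-Reasoning
      zs ws : List (Fin (n G))
      zs = toList Z
      ws = toList (W ∖ Z)
      unique : Unique (zs ++ ws)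
      unique = UniqueP.++⁺ (toList-unique Z) (toList-unique (W ∖ Z)) λ (x∈zs , x∈ws) →
        SubsetP.x∈∁p⇒x∉p (proj₂ (SubsetP.x∈p∩q⁻ W (∁ Z) (∈-toList⁻ (W ∖ Z) x∈ws))) (∈-toList⁻ Z x∈zs)
      length≡ : length (zs ++ ws) ≡ ∣ Z ∣ ℕ.+ ∣ W ∖ Z ∣
      length≡ = trans (ListP.length-++ zs) (cong₂ ℕ._+_ (length-toList Z) (length-toList (W ∖ Z)))
      length≤ : length (zs ++ ws) ℕ.≤ ∣ Z ∣ ℕ.+ ∣ W ∣
      length≤ = ℕP.≤-trans (ℕP.≤-reflexive length≡) (ℕP.+-monoʳ-≤ ∣ Z ∣ (SubsetP.∣p∩q∣≤∣p∣ W (∁ Z)))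
      0<length : 0 ℕ.< length (zs ++ ws)
      0<length = ℕP.<-≤-trans 0<∣Z∣ (ℕP.≤-trans (ℕP.m≤m+n ∣ Z ∣ ∣ W ∖ Z ∣) (ℕP.≤-reflexive (sym length≡)))

    2rw≤k[k[r+w]+2r²] : ∀ W Z → Z ⊆ admissible W → 0 ℕ.< ∣ Z ∣ →
                        let r = ℕ→ℚ ∣ Z ∣; w = ℕ→ℚ ∣ W ∣ in
                        ℕ→ℚ 2 * (r * w) ≤ k * (k * (r + w) + ℕ→ℚ 2 * (r * r))
    2rw≤k[k[r+w]+2r²] W Z Z⊆ 0<∣Z∣ = begin
      two * (r * w)                                    ≡⟨ cong (two *_) (ℕ→ℚ-* ∣ Z ∣ ∣ W ∣) ⟨
      two * ℕ→ℚ (∣ Z ∣ ℕ.* ∣ W ∣)                      ≤⟨ *-monoˡ-≤-nonNeg two (rw≤k[e+r²] W Z Z⊆) ⟩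
      two * (k * ℕ→ℚ (e ℕ.+ ∣ Z ∣ ℕ.* ∣ Z ∣))          ≡⟨ cong (λ x → two * (k * x)) (trans (ℕ→ℚ-+ e (∣ Z ∣ ℕ.* ∣ Z ∣)) (cong (ℕ→ℚ e +_) (ℕ→ℚ-* ∣ Z ∣ ∣ Z ∣))) ⟩
      two * (k * (ℕ→ℚ e + r * r))                      ≤⟨ *-monoˡ-≤-nonNeg two (k*-mono-≤ (+-monoˡ-≤ (r * r) (e≤∇[r+w] W Z 0<∣Z∣))) ⟩
      two * (k * (nabla * (r + w) + r * r))            ≡⟨ solve 3 (λ ∇ r w →
        con two :* ((con two :* ∇) :* (∇ :* (r :+ w) :+ r :* r))
          := (con two :* ∇) :* ((con two :* ∇) :* (r :+ w) :+ con two :* (r :* r))) refl nabla r w ⟩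
      k * (k * (r + w) + two * (r * r))                ∎
      where
      open ≤-Reasoning
      open ℚSolver.+-*-Solver
      two r w : ℚ
      two = ℕ→ℚ 2
      r = ℕ→ℚ ∣ Z ∣
      w = ℕ→ℚ ∣ W ∣
      e : ℕ
      e = crossEdges G (toList Z) (toList (W ∖ Z))

    admissible⇒1≤k : ∀ {W z} → Admissible W z → 1ℚ ≤ k
    admissible⇒1≤k {W} {z} (w≤kd , ℓ≤d) =
      *-cancelʳ-≤-pos d {{ℚ.positive (<-≤-trans (ℕ→ℚ-mono-< {0} {1} ℕP.≤-refl) (≤-trans 1≤ℓ ℓ≤d))}}
        (≤-trans (≤-reflexive (*-identityˡ d)) (≤-trans (ℕ→ℚ-mono-≤ (SubsetP.∣p∩q∣≤∣q∣ (N[_] G z) W))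
          w≤kd))
      where
      d : ℚ
      d = ℕ→ℚ ∣ N[_] G z ∩ W ∣
      1≤ℓ : 1ℚ ≤ ℓ
      1≤ℓ = +-monoˡ-≤ 1ℚ (*-nonNeg (ℕ→ℚ-nonNeg 4) (^ℚ-nonNeg 3 0≤k))

    admissible⇒ℓ≤∣W∣ : ∀ {W z} → Admissible W z → ℓ ≤ ℕ→ℚ ∣ W ∣
    admissible⇒ℓ≤∣W∣ {W} {z} (_ , ℓ≤d) = ≤-trans ℓ≤d (ℕ→ℚ-mono-≤ (SubsetP.∣p∩q∣≤∣q∣ (N[_] G z) W))

    module _ (c : ℕ) (c≤2k² : ℕ→ℚ c ≤ ℕ→ℚ 2 * (k * k)) (2k²<1+c : ℕ→ℚ 2 * (k * k) < ℕ→ℚ (suc c)) where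

      no-admissible-set-of-size-1+c : ∀ W Z → Z ⊆ admissible W → ∣ Z ∣ ≡ suc c → Empty
      no-admissible-set-of-size-1+c W Z Z⊆ ∣Z∣≡1+c = <-irrefl refl (<-≤-trans
        (k[k[r+w]+2r²]<2rw {k} {r} {ℕ→ℚ ∣ W ∣} (admissible⇒1≤k admissible-z) (admissible⇒ℓ≤∣W∣ admissible-z) 2k²<r r≤2k²+1)
        (2rw≤k[k[r+w]+2r²] W Z Z⊆ 0<∣Z∣))
        where
        r : ℚ
        r = ℕ→ℚ ∣ Z ∣
        0<∣Z∣ : 0 ℕ.< ∣ Z ∣
        0<∣Z∣ = subst (0 ℕ.<_) (sym ∣Z∣≡1+c) (s≤s z≤n)
        2k²<r : ℕ→ℚ 2 * (k * k) < r
        2k²<r = subst (λ m → ℕ→ℚ 2 * (k * k) < ℕ→ℚ m) (sym ∣Z∣≡1+c) 2k²<1+c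
        r≤2k²+1 : r ≤ ℕ→ℚ 2 * (k * k) + 1ℚ
        r≤2k²+1 = begin
          r               ≡⟨ cong ℕ→ℚ ∣Z∣≡1+c ⟩
          ℕ→ℚ (suc c)     ≡⟨ ℕ→ℚ-suc c ⟩
          1ℚ + ℕ→ℚ c      ≡⟨ +-comm 1ℚ (ℕ→ℚ c) ⟩
          ℕ→ℚ c + 1ℚ      ≤⟨ +-monoˡ-≤ 1ℚ c≤2k² ⟩
          ℕ→ℚ 2 * (k * k) + 1ℚ ∎
          where open ≤-Reasoning
        admissible-z : Admissible W (proj₁ (∣p∣>0⇒Nonempty Z 0<∣Z∣))
        admissible-z = ∈-subsetOf⁻ (admissible? W) (Z⊆ (proj₂ (∣p∣>0⇒Nonempty Z 0<∣Z∣)))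

      ∣admissible∣≤c : ∀ W → ∣ admissible W ∣ ℕ.≤ c
      ∣admissible∣≤c W = decidable-stable (∣ admissible W ∣ ℕ.≤? c) λ ∣adm∣≰c →
        let Z , Z⊆ , ∣Z∣≡1+c = ⊆-of-size (suc c) (admissible W) (ℕP.≰⇒> ∣adm∣≰c)
        in no-admissible-set-of-size-1+c W Z Z⊆ ∣Z∣≡1+c

    reachable : ℕ → Subset (n G) → Subset (n G)
    reachable zero    W = ⊥
    reachable (suc j) W = ⋃[ z ∈ admissible W ] (⁅ z ⁆ ∪ reachable j (W ∖ N[_] G z))

    ∈-reachable : ∀ j W us {z} → Steps W us → length us ℕ.≤ j → z ∈ˡ us → z ∈ reachable j W
    ∈-reachable (suc j) W (u ∷ us) (strong , heavy , steps) (s≤s len≤j) z∈ =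
      ∈-⋃∈⁺ (admissible W) (λ z → ⁅ z ⁆ ∪ reachable j (W ∖ N[_] G z))
            (∈-subsetOf⁺ (admissible? W) (strong , heavy)) (in-branch z∈)
      where
      in-branch : ∀ {z} → z ∈ˡ u ∷ us → z ∈ ⁅ u ⁆ ∪ reachable j (W ∖ N[_] G u)
      in-branch (here refl) = SubsetP.p⊆p∪q _ (SubsetP.x∈⁅x⁆ u)
      in-branch (there z∈)  = SubsetP.q⊆p∪q ⁅ u ⁆ _ (∈-reachable j (W ∖ N[_] G u) us steps len≤j z∈)

    module _ (c : ℕ) (∣admissible∣≤c : ∀ W → ∣ admissible W ∣ ℕ.≤ c) where

      ∣reachable∣≤j*c^j : ∀ j W → ∣ reachable j W ∣ ℕ.≤ j ℕ.* c ℕ.^ j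
      ∣reachable∣≤j*c^j zero    W = ℕP.≤-reflexive (SubsetP.∣⊥∣≡0 (n G))
      ∣reachable∣≤j*c^j (suc j) W = begin
        ∣ reachable (suc j) W ∣          ≤⟨ ∣⋃∈∣≤ (admissible W) _ (1 ℕ.+ j ℕ.* c ℕ.^ j) branch≤ ⟩
        ∣ admissible W ∣ ℕ.* (1 ℕ.+ j ℕ.* c ℕ.^ j) ≤⟨ ℕP.*-monoˡ-≤ _ (∣admissible∣≤c W) ⟩
        c ℕ.* (1 ℕ.+ j ℕ.* c ℕ.^ j)       ≡⟨ solve 3 (λ c j x → c :* (con 1 :+ j :* x) := c :+ j :* (c :* x)) refl c j (c ℕ.^ j) ⟩
        c ℕ.+ j ℕ.* c ℕ.^ suc j           ≤⟨ ℕP.+-monoˡ-≤ (j ℕ.* c ℕ.^ suc j) (m≤m^[1+n] c j) ⟩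
        c ℕ.^ suc j ℕ.+ j ℕ.* c ℕ.^ suc j ∎
        where
        open ℕP.≤-Reasoning
        open ℕSolver.+-*-Solver
        branch≤ : ∀ z → z ∈ admissible W → ∣ ⁅ z ⁆ ∪ reachable j (W ∖ N[_] G z) ∣ ℕ.≤ 1 ℕ.+ j ℕ.* c ℕ.^ j
        branch≤ z _ = ℕP.≤-trans (∣p∪q∣≤∣p∣+∣q∣ ⁅ z ⁆ _)
                        (ℕP.+-mono-≤ (ℕP.≤-reflexive (SubsetP.∣⁅x⁆∣≡1 z)) (∣reachable∣≤j*c^j j (W ∖ N[_] G z)))

    𝒫⊆reachable : ∀ K → k < ℕ→ℚ (suc K) → ∀ u P → (∀ z → (z ∈ P) ⇔ InP u z) → P ⊆ reachable K (N G u)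
    𝒫⊆reachable K k<1+K u P P⇔𝒫 {z} z∈P =
      let _ , us , (length≤k , _ , steps) , z∈us = Equivalence.to (P⇔𝒫 z) z∈P
      in ∈-reachable K (N G u) us steps (≤-floor length≤k k<1+K) z∈us

    ∣𝒫∣≤K*c^K : ∀ c → ℕ→ℚ c ≤ ℕ→ℚ 2 * (k * k) → ℕ→ℚ 2 * (k * k) < ℕ→ℚ (suc c) →
                 ∀ K → k < ℕ→ℚ (suc K) → ∀ u P → (∀ z → (z ∈ P) ⇔ InP u z) → ∣ P ∣ ℕ.≤ K ℕ.* c ℕ.^ K
    ∣𝒫∣≤K*c^K c c≤2k² 2k²<1+c K k<1+K u P P⇔𝒫 =
      ℕP.≤-trans (SubsetP.p⊆q⇒∣p∣≤∣q∣ (𝒫⊆reachable K k<1+K u P P⇔𝒫))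
                 (∣reachable∣≤j*c^j c (∣admissible∣≤c c c≤2k² 2k²<1+c) K (N G u))

    ∣𝒫∣-bound : ∀ u → CardPBound u
    ∣𝒫∣-bound u P P⇔𝒫 =
      let c , c≤2k² , 2k²<1+c = ℕ-floor (ℕ→ℚ 2 * (k * k)) 0≤2k²
          K , K≤k , k<1+K     = ℕ-floor k 0≤k
      in m≤K*c^K⇒m≤[2k]^[2k+1] c K 0≤k c≤2k² K≤k (∣𝒫∣≤K*c^K c c≤2k² 2k²<1+c K k<1+K u P P⇔𝒫)

  IsKDS⇒InP : ∀ G k t v s vs → Params.IsKDS G k t v s vs →
              ∀ i → 1 ℕ.≤ i → i ℕ.≤ s ∸ 1 → Params.InP G k (vs i) (vs (i ℕ.+ 1))
  IsKDS⇒InP G k t v s vs (1≤s , _ , _ , _ , _ , _ , vᵢ₊₁∈𝒫[vᵢ]) i 1≤i i≤s-1 =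
    subst (λ j → Params.InP G k (vs j) (vs (i ℕ.+ 1))) (ℕP.m+n∸n≡m i 1)
          (vᵢ₊₁∈𝒫[vᵢ] (i ℕ.+ 1) (ℕP.+-monoˡ-≤ 1 1≤i)
                       (ℕP.≤-trans (ℕP.+-monoˡ-≤ 1 i≤s-1) (ℕP.≤-reflexive (ℕP.m∸n+n≡m 1≤s))))

open import Defs
open import Data.Nat as ℕ using (ℕ; _+_; _∸_)
open import Data.Fin using (Fin)
open import Data.Fin.Subset using (∣_∣)
open import Data.Rational as ℚ using (ℚ; _*_)
open import Data.Product using (_×_)
import Data.Rational.Properties as ℚP
open import Data.Product using (_,_; proj₁)

open PseudoCovers using (IsKDS⇒InP; ∣𝒫∣-bound)

lemma8 : (G : Graph) (nabla : ℚ) → IsNabla₁ G nabla →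
         let k = ℕ→ℚ 2 * nabla in
         StandingAssumption G k →
         (t : ℕ) → IsLeastNoKtt G t →
         (v : Fin (n G)) (s : ℕ) (vs : ℕ → Fin (n G)) →
         Params.IsMaximalKDS G k t v s vs →
         ∀ i → 1 ℕ.≤ i → i ℕ.≤ s ∸ 1 →
           Params.InP G k (vs i) (vs (i + 1))
           × Params.ℓ G k ℚ.≤ ℕ→ℚ ∣ N G (vs i) ∣
           × Params.CardPBound G k (vs i)
lemma8 G nabla ∇₁ _ t _ v s vs (kds , _) i 1≤i i≤s-1 =
  vᵢ₊₁∈𝒫[vᵢ] , ℚP.<⇒≤ (proj₁ vᵢ₊₁∈𝒫[vᵢ]) , ∣𝒫∣-bound G nabla ∇₁ (vs i)
  where
  vᵢ₊₁∈𝒫[vᵢ] : Params.InP G (ℕ→ℚ 2 * nabla) (vs i) (vs (i + 1))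
  vᵢ₊₁∈𝒫[vᵢ] = IsKDS⇒InP G (ℕ→ℚ 2 * nabla) t v s vs kds i 1≤i i≤s-1
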